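{- Let $r,n\geq 1$, let $G$ be a group, for each $i=1,\ldots,r$ let $\alpha_i:G\to S_n$ be an epimorphism, and let $\alpha=\prod_{i=1}^r\alpha_i:G\to S_n^r$. Assume that the homomorphism $\beta:G\to S_n^r/A_n^r$ obtained by composing $\alpha$ with the natural quotient map $S_n^r\to S_n^r/A_n^r$ is surjective. Then $\alpha$ is surjective.
   Context: $S_n$ is the symmetric group and $A_n$ the alternating group on $n$ letters; for $n\geq 2$, $S_n^r/A_n^r\cong(\mathbb{Z}/2\mathbb{Z})^r$. -}

module Defs where

open import Level using (0ℓ)
open import Data.Nat using (ℕ; _<ᵇ_)
open import Data.Nat.Divisibility using (_∣_)
open import Data.Bool using (Bool; if_then_else_; _∧_)
open import Data.Fin using (Fin; toℕ)
open import Data.List using (List; map; allFin)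
open import Data.Nat.ListAction using (sum)
open import Data.Fin.Permutation as P using (Permutation′; _⟨$⟩ʳ_; _∘ₚ_; flip)
open import Algebra.Bundles.Raw using (RawGroup)

-- The symmetric group S_n, realised concretely as permutations of Fin n,
-- with pointwise equality and multiplication (σ · τ) x = σ (τ x).
Sym : ℕ → Set
Sym n = Permutation′ n

_·_ : ∀ {n} → Sym n → Sym n → Sym n
σ · τ = τ ∘ₚ σ

SymRaw : ℕ → RawGroup 0ℓ 0ℓ
SymRaw n = record
  { Carrier = Sym n
  ; _≈_     = P._≈_
  ; _∙_     = _·_
  ; ε       = P.id
  ; _⁻¹     = flip
  }

SymPowRaw : ℕ → ℕ → RawGroup 0ℓ 0ℓ
SymPowRaw r n = record
  { Carrier = Fin r → Sym n
  ; _≈_     = λ σ τ → ∀ i → σ i P.≈ τ i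
  ; _∙_     = λ σ τ i → σ i · τ i
  ; ε       = λ _ → P.id
  ; _⁻¹     = λ σ i → flip (σ i)
  }

inversions : ∀ {n} → Sym n → ℕ
inversions {n} σ =
  sum (map (λ i → sum (map (λ j →
        if (toℕ i <ᵇ toℕ j) ∧ (toℕ (σ ⟨$⟩ʳ j) <ᵇ toℕ (σ ⟨$⟩ʳ i)) then 1 else 0)
      (allFin n))) (allFin n))

IsEven : ∀ {n} → Sym n → Set
IsEven σ = 2 ∣ inversions σ

-- Equality in the quotient S_n^r / A_n^r: σ and τ lie in the same coset of
-- A_n^r, i.e. σ_i⁻¹ τ_i ∈ A_n for every i.
_≈A_ : ∀ {r n} → (Fin r → Sym n) → (Fin r → Sym n) → Set
σ ≈A τ = ∀ i → IsEven (flip (σ i) · τ i)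

-- Let H ≤ S_n^r be the image of G. By induction on k, every tuple x ∈ S_n^r is matched by some
-- h ∈ H exactly in the coordinates i < k and up to sign in the coordinates i ≥ k: for k = 0 this
-- is the surjectivity of β, for k = r it is the theorem. In the step at coordinate k, the k-th
-- coordinates of those h ∈ H that are trivial before k and even after k form a subgroup N of S_n,
-- normal because α_k is onto, and by the induction hypothesis N has elements of both signs.
-- A normal subgroup of S_n containing an odd σ is all of S_n: commutators of σ with
-- transpositions lead to a 3-cycle in N, its conjugates give every product of two
-- transpositions, and these generate A_n.

module Submission where

open import Defs
open import Level using (Level)
open import Data.Nat using (ℕ; _≥_)
open import Data.Fin using (Fin)
open import Algebra.Bundles using (Group)
open import Algebra.Morphism.Structures using (module GroupMorphisms)
open import Function.Definitions using (Surjective)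
open import Data.Fin.Permutation as P using (_⟨$⟩ʳ_; flip; transpose; inverseˡ; inverseʳ; lift₀; remove)
open import Algebra.Bundles.Raw using (RawGroup)

open import Data.Bool using (Bool; true; false; if_then_else_; _∧_)
open import Data.Bool.Properties using (T-≡; ¬-not)
open import Data.Fin using (zero; suc; toℕ; inject₁; fromℕ<)
open import Data.Fin.Properties using (_≟_; suc-injective; toℕ-injective; toℕ-fromℕ<; toℕ<n; any?; ¬∀⟶∃¬)
import Data.Fin.Permutation.Components as PC
open import Data.List using (List; []; _∷_; map; allFin; tabulate; length; _++_)
open import Data.List.Properties using (map-tabulate; tabulate-cong)
open import Data.Nat using (zero; suc; _+_; _<_; _≤_; _<ᵇ_; z≤n; s≤s; parity)
open import Data.Nat.Divisibility using (divides)
open import Data.Nat.ListAction using (sum)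
open import Data.Nat.Properties
  using (+-suc; <-cmp; <⇒<ᵇ; <ᵇ⇒<; ≤⇒≯; <⇒≤; <⇒≢; ≤-refl; ≤-reflexive; m<1+n⇒m<n∨m≡n; +-commutativeSemigroup)
open import Algebra.Properties.CommutativeSemigroup +-commutativeSemigroup using (x∙yz≈y∙xz)
open import Data.Parity.Base as ℙ using (Parity; 0ℙ; 1ℙ)
import Data.Parity.Properties as ℙₚ
open import Algebra.Properties.CommutativeSemigroup ℙₚ.+-commutativeSemigroup
  using () renaming (x∙yz≈y∙xz to ℙ-x∙yz≈y∙xz)
open import Data.Product using (∃-syntax; _×_; _,_; proj₁; proj₂)
open import Data.Sum as Sum using (_⊎_; inj₁; inj₂)
open import Data.Vec.Functional using (updateAt)
open import Data.Vec.Functional.Properties using (updateAt-updates; updateAt-minimal)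
open import Function using (_∘_; Injection)
open import Function.Bundles using (Equivalence)
open import Function.Properties.Inverse using (↔⇒↣)
open import Relation.Binary using (Tri; tri<; tri≈; tri>)
open import Relation.Binary.PropositionalEquality
  using (_≡_; _≢_; refl; sym; trans; cong; cong₂; subst; ≢-sym; module ≡-Reasoning)
open import Relation.Nullary using (¬_; yes; no; ¬?; _×-dec_)
open import Relation.Nullary.Negation using (contradiction)

module _ {n : ℕ} where

  injective : (σ : Sym n) {x y : Fin n} → σ ⟨$⟩ʳ x ≡ σ ⟨$⟩ʳ y → x ≡ y
  injective σ = Injection.injective (↔⇒↣ σ)

  flip-cong : {σ τ : Sym n} → σ P.≈ τ → flip σ P.≈ flip τ
  flip-cong {σ} {τ} p x = injective τ (trans (sym (p _)) (trans (inverseʳ σ) (sym (inverseʳ τ))))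

  ·-inverseʳ : (σ : Sym n) → σ · flip σ P.≈ P.id
  ·-inverseʳ σ _ = inverseʳ σ

  transpose-ˡ : (a b : Fin n) → transpose a b ⟨$⟩ʳ a ≡ b
  transpose-ˡ a b with a ≟ a
  ... | yes _ = refl
  ... | no a≢a = contradiction refl a≢a

  transpose-ʳ : (a b : Fin n) → transpose a b ⟨$⟩ʳ b ≡ a
  transpose-ʳ a b with b ≟ a
  ... | yes b≡a = b≡a
  ... | no _ with b ≟ b
  ...   | yes _ = refl
  ...   | no b≢b = contradiction refl b≢b

  transpose-fix : {a b x : Fin n} → x ≢ a → x ≢ b → transpose a b ⟨$⟩ʳ x ≡ x
  transpose-fix {a} {b} {x} x≢a x≢b with x ≟ a
  ... | yes x≡a = contradiction x≡a x≢a
  ... | no _ with x ≟ b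
  ...   | yes x≡b = contradiction x≡b x≢b
  ...   | no _ = refl

  -- Case analysis through this type, instead of `with x ≟ a`, keeps Agda from abstracting
  -- the test x ≟ a that `transpose` performs internally.
  data TransposeCase (a b x : Fin n) : Set where
    at-ˡ : x ≡ a → TransposeCase a b x
    at-ʳ : x ≡ b → TransposeCase a b x
    elsewhere : x ≢ a → x ≢ b → TransposeCase a b x

  transposeCase : (a b x : Fin n) → TransposeCase a b x
  transposeCase a b x with x ≟ a | x ≟ b
  ... | yes x≡a | _ = at-ˡ x≡a
  ... | no _ | yes x≡b = at-ʳ x≡b
  ... | no x≢a | no x≢b = elsewhere x≢a x≢b

  transpose-comm : (a b : Fin n) → transpose a b P.≈ transpose b a
  transpose-comm a b x with transposeCase a b x
  ... | at-ˡ refl = trans (transpose-ˡ x b) (sym (transpose-ʳ b x))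
  ... | at-ʳ refl = trans (transpose-ʳ a x) (sym (transpose-ˡ x a))
  ... | elsewhere x≢a x≢b = trans (transpose-fix x≢a x≢b) (sym (transpose-fix x≢b x≢a))

  transpose-involutive : (a b : Fin n) → transpose a b · transpose a b P.≈ P.id
  transpose-involutive a b x =
    trans (cong (transpose a b ⟨$⟩ʳ_) (transpose-comm a b x)) (PC.transpose-inverse a b)

  transpose-conj : (π : Sym n) (a b : Fin n) →
                   (π · transpose a b) · flip π P.≈ transpose (π ⟨$⟩ʳ a) (π ⟨$⟩ʳ b)
  transpose-conj π a b x with transposeCase (π ⟨$⟩ʳ a) (π ⟨$⟩ʳ b) x
  ... | at-ˡ refl = trans (cong (λ y → π ⟨$⟩ʳ (transpose a b ⟨$⟩ʳ y)) (inverseˡ π))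
                          (trans (cong (π ⟨$⟩ʳ_) (transpose-ˡ a b)) (sym (transpose-ˡ x _)))
  ... | at-ʳ refl = trans (cong (λ y → π ⟨$⟩ʳ (transpose a b ⟨$⟩ʳ y)) (inverseˡ π))
                          (trans (cong (π ⟨$⟩ʳ_) (transpose-ʳ a b)) (sym (transpose-ʳ _ x)))
  ... | elsewhere x≢πa x≢πb =
    trans (cong (π ⟨$⟩ʳ_) (transpose-fix (moved x≢πa) (moved x≢πb)))
          (trans (inverseʳ π) (sym (transpose-fix x≢πa x≢πb)))
    where
    moved : {c : Fin n} → x ≢ π ⟨$⟩ʳ c → flip π ⟨$⟩ʳ x ≢ c
    moved x≢πc refl = x≢πc (sym (inverseʳ π))

  redirect : (π : Sym n) (x y : Fin n) →
             ∃[ π′ ] π′ ⟨$⟩ʳ x ≡ y × (∀ z → z ≢ x → π ⟨$⟩ʳ z ≢ y → π′ ⟨$⟩ʳ z ≡ π ⟨$⟩ʳ z)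
  redirect π x y =
    transpose (π ⟨$⟩ʳ x) y · π , transpose-ˡ (π ⟨$⟩ʳ x) y ,
    λ z z≢x πz≢y → transpose-fix (z≢x ∘ injective π) πz≢y

  2-transitive : {a b x y : Fin n} → a ≢ b → x ≢ y →
                 ∃[ π ] π ⟨$⟩ʳ a ≡ x × π ⟨$⟩ʳ b ≡ y
  2-transitive {a} {b} {x} {y} a≢b x≢y with redirect P.id a x
  ... | π₁ , π₁a , _ with redirect π₁ b y
  ...   | π₂ , π₂b , π₂-fix =
    π₂ , trans (π₂-fix a a≢b (λ π₁a≡y → x≢y (trans (sym π₁a) π₁a≡y))) π₁a , π₂b

  3-transitive : {a b c x y z : Fin n} → a ≢ b → a ≢ c → b ≢ c → x ≢ y → x ≢ z → y ≢ z →
                 ∃[ π ] π ⟨$⟩ʳ a ≡ x × π ⟨$⟩ʳ b ≡ y × π ⟨$⟩ʳ c ≡ z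
  3-transitive {a} {b} {c} {x} {y} {z} a≢b a≢c b≢c x≢y x≢z y≢z with 2-transitive a≢b x≢y
  ... | π₂ , π₂a , π₂b with redirect π₂ c z
  ...   | π₃ , π₃c , π₃-fix =
    π₃ , trans (π₃-fix a a≢c (λ e → x≢z (trans (sym π₂a) e))) π₂a
       , trans (π₃-fix b b≢c (λ e → y≢z (trans (sym π₂b) e))) π₂b , π₃c

among-two : ∀ {n} {a b : Fin n} → ¬ (∃[ x ] x ≢ a × x ≢ b) → ∀ x → x ≡ a ⊎ x ≡ b
among-two {a = a} {b} none x with x ≟ a | x ≟ b
... | yes x≡a | _ = inj₁ x≡a
... | no _ | yes x≡b = inj₂ x≡b
... | no x≢a | no x≢b = contradiction (x , x≢a , x≢b) none

among-four : ∀ {n} {a b c d : Fin n} → ¬ (∃[ x ] x ≢ a × x ≢ b × x ≢ c × x ≢ d) →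
             ∀ x → x ≡ a ⊎ x ≡ b ⊎ x ≡ c ⊎ x ≡ d
among-four {a = a} {b} {c} {d} none x with x ≟ a | x ≟ b | x ≟ c | x ≟ d
... | yes x≡a | _ | _ | _ = inj₁ x≡a
... | no _ | yes x≡b | _ | _ = inj₂ (inj₁ x≡b)
... | no _ | no _ | yes x≡c | _ = inj₂ (inj₂ (inj₁ x≡c))
... | no _ | no _ | no _ | yes x≡d = inj₂ (inj₂ (inj₂ x≡d))
... | no x≢a | no x≢b | no x≢c | no x≢d = contradiction (x , x≢a , x≢b , x≢c , x≢d) none

transpose-among-two : ∀ {n} {a b u v : Fin n} → (∀ x → x ≡ a ⊎ x ≡ b) → u ≢ v →
                      transpose u v P.≈ transpose a b
transpose-among-two {u = u} {v} among u≢v with among u | among v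
... | inj₁ refl | inj₁ refl = contradiction refl u≢v
... | inj₁ refl | inj₂ refl = λ _ → refl
... | inj₂ refl | inj₁ refl = transpose-comm u v
... | inj₂ refl | inj₂ refl = contradiction refl u≢v

<ᵇ-true : ∀ {a b} → a < b → (a <ᵇ b) ≡ true
<ᵇ-true a<b = Equivalence.to T-≡ (<⇒<ᵇ a<b)

<ᵇ-false : ∀ {a b} → b ≤ a → (a <ᵇ b) ≡ false
<ᵇ-false {a} {b} b≤a = ¬-not (λ a<ᵇb → ≤⇒≯ b≤a (<ᵇ⇒< a b (Equivalence.from T-≡ a<ᵇb)))

𝟙 : Bool → ℕ
𝟙 b = if b then 1 else 0

countBelow : ℕ → ∀ {n} → (Fin n → ℕ) → ℕ
countBelow x {zero} h = 0
countBelow x {suc n} h = 𝟙 (h zero <ᵇ x) + countBelow x (h ∘ suc)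

inversionCount : ∀ {n} → (Fin n → ℕ) → ℕ
inversionCount {zero} f = 0
inversionCount {suc n} f = countBelow (f zero) (f ∘ suc) + inversionCount (f ∘ suc)

sum-tabulate-countBelow : ∀ x {n} (h : Fin n → ℕ) →
                          sum (tabulate (λ j → 𝟙 (h j <ᵇ x))) ≡ countBelow x h
sum-tabulate-countBelow x {zero} h = refl
sum-tabulate-countBelow x {suc n} h = cong (𝟙 (h zero <ᵇ x) +_) (sum-tabulate-countBelow x (h ∘ suc))

tabulated-inversionCount : ∀ {n} (f : Fin n → ℕ) →
  sum (tabulate (λ i → sum (tabulate (λ j → 𝟙 ((toℕ i <ᵇ toℕ j) ∧ (f j <ᵇ f i)))))) ≡ inversionCount f
tabulated-inversionCount {zero} f = refl
tabulated-inversionCount {suc n} f =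
  cong₂ _+_ (sum-tabulate-countBelow (f zero) (f ∘ suc)) (tabulated-inversionCount (f ∘ suc))

inversions≡inversionCount : ∀ {n} (σ : Sym n) → inversions σ ≡ inversionCount (toℕ ∘ (σ ⟨$⟩ʳ_))
inversions≡inversionCount {n} σ = begin
  inversions σ                                   ≡⟨ sum-map-allFin _ ⟩
  sum (tabulate (λ i → sum (map (row i) (allFin n)))) ≡⟨ cong sum (tabulate-cong (sum-map-allFin ∘ row)) ⟩
  sum (tabulate (λ i → sum (tabulate (row i))))  ≡⟨ tabulated-inversionCount f ⟩
  inversionCount f                               ∎
  where
  open ≡-Reasoning
  f : Fin n → ℕ
  f = toℕ ∘ (σ ⟨$⟩ʳ_)
  row : Fin n → Fin n → ℕ
  row i j = 𝟙 ((toℕ i <ᵇ toℕ j) ∧ (f j <ᵇ f i))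
  sum-map-allFin : (h : Fin n → ℕ) → sum (map h (allFin n)) ≡ sum (tabulate h)
  sum-map-allFin h = cong sum (map-tabulate (λ i → i) h)

countBelow-cong : ∀ x {n} {h g : Fin n → ℕ} → (∀ i → h i ≡ g i) → countBelow x h ≡ countBelow x g
countBelow-cong x {zero} h≗g = refl
countBelow-cong x {suc n} h≗g =
  cong₂ _+_ (cong (λ y → 𝟙 (y <ᵇ x)) (h≗g zero)) (countBelow-cong x (h≗g ∘ suc))

inversionCount-cong : ∀ {n} {f g : Fin n → ℕ} → (∀ i → f i ≡ g i) → inversionCount f ≡ inversionCount g
inversionCount-cong {zero} f≗g = refl
inversionCount-cong {suc n} {f} f≗g =
  cong₂ _+_ (trans (cong (λ x → countBelow x (f ∘ suc)) (f≗g zero)) (countBelow-cong _ (f≗g ∘ suc)))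
            (inversionCount-cong (f≗g ∘ suc))

countBelow-all-above : ∀ x {n} (h : Fin n → ℕ) → (∀ i → x < h i) → countBelow x h ≡ 0
countBelow-all-above x {zero} h x<h = refl
countBelow-all-above x {suc n} h x<h =
  cong₂ _+_ (cong 𝟙 (<ᵇ-false (<⇒≤ (x<h zero)))) (countBelow-all-above x (h ∘ suc) (x<h ∘ suc))

inversionCount-increasing : ∀ {n} (f : Fin n → ℕ) → (∀ i j → toℕ i < toℕ j → f i < f j) →
                            inversionCount f ≡ 0
inversionCount-increasing {zero} f f-inc = refl
inversionCount-increasing {suc n} f f-inc =
  cong₂ _+_ (countBelow-all-above (f zero) (f ∘ suc) (λ i → f-inc zero (suc i) (s≤s z≤n)))
            (inversionCount-increasing (f ∘ suc) (λ i j → f-inc (suc i) (suc j) ∘ s≤s))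

adjacent : ∀ {m} → Fin m → Sym (suc m)
adjacent k = transpose (inject₁ k) (suc k)

adjacent-suc : ∀ {m} (k : Fin m) (x : Fin (suc m)) →
               adjacent (suc k) ⟨$⟩ʳ suc x ≡ suc (adjacent k ⟨$⟩ʳ x)
adjacent-suc k x = P.lift₀-transpose (inject₁ k) (suc k) (suc x)

countBelow-adjacent : ∀ x {m} (k : Fin m) (h : Fin (suc m) → ℕ) →
                      countBelow x (h ∘ (adjacent k ⟨$⟩ʳ_)) ≡ countBelow x h
countBelow-adjacent x {suc m} zero h = x∙yz≈y∙xz (𝟙 (h (suc zero) <ᵇ x)) (𝟙 (h zero <ᵇ x)) _
countBelow-adjacent x {suc m} (suc k) h = cong (𝟙 (h zero <ᵇ x) +_) (begin
  countBelow x (h ∘ (adjacent (suc k) ⟨$⟩ʳ_) ∘ suc) ≡⟨ countBelow-cong x (cong h ∘ adjacent-suc k) ⟩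
  countBelow x (h ∘ suc ∘ (adjacent k ⟨$⟩ʳ_))       ≡⟨ countBelow-adjacent x k (h ∘ suc) ⟩
  countBelow x (h ∘ suc)                             ∎)
  where open ≡-Reasoning

-- The inversion counts of f ∘ (0 1) and of f consist of the comparison of the first two values,
-- the number of remaining values below the first value (X, resp. Y) and below the second
-- value (Y, resp. X), and the inversions I among the remaining values.
exchange-adjacent : ∀ {a b} X Y I → a < b → 𝟙 (a <ᵇ b) + X + (Y + I) ≡ suc (𝟙 (b <ᵇ a) + Y + (X + I))
exchange-adjacent {a} {b} X Y I a<b = begin
  𝟙 (a <ᵇ b) + X + (Y + I)     ≡⟨ cong (λ t → 𝟙 t + X + (Y + I)) (<ᵇ-true a<b) ⟩
  suc (X + (Y + I))             ≡⟨ cong suc (x∙yz≈y∙xz X Y I) ⟩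
  suc (Y + (X + I))             ≡⟨ cong (λ t → suc (𝟙 t + Y + (X + I))) (<ᵇ-false (<⇒≤ a<b)) ⟨
  suc (𝟙 (b <ᵇ a) + Y + (X + I)) ∎
  where open ≡-Reasoning

OneApart : ℕ → ℕ → Set
OneApart a b = a ≡ suc b ⊎ b ≡ suc a

OneApart-+ : ∀ c {a b} → OneApart a b → OneApart (c + a) (c + b)
OneApart-+ c = Sum.map (λ a≡1+b → trans (cong (c +_) a≡1+b) (+-suc c _))
                       (λ b≡1+a → trans (cong (c +_) b≡1+a) (+-suc c _))

inversionCount-adjacent : ∀ {m} (k : Fin m) (f : Fin (suc m) → ℕ) → f (inject₁ k) ≢ f (suc k) →
                          OneApart (inversionCount (f ∘ (adjacent k ⟨$⟩ʳ_))) (inversionCount f)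
inversionCount-adjacent {suc m} zero f f₀≢f₁ = by-comparison (<-cmp (f zero) (f (suc zero)))
  where
  X Y I : ℕ
  X = countBelow (f (suc zero)) (λ x → f (suc (suc x)))
  Y = countBelow (f zero) (λ x → f (suc (suc x)))
  I = inversionCount (λ x → f (suc (suc x)))
  by-comparison : Tri (f zero < f (suc zero)) (f zero ≡ f (suc zero)) (f (suc zero) < f zero) →
                  OneApart (inversionCount (f ∘ (adjacent zero ⟨$⟩ʳ_))) (inversionCount f)
  by-comparison (tri< f₀<f₁ _ _) = inj₁ (exchange-adjacent X Y I f₀<f₁)
  by-comparison (tri≈ _ f₀≡f₁ _) = contradiction f₀≡f₁ f₀≢f₁
  by-comparison (tri> _ _ f₁<f₀) = inj₂ (exchange-adjacent Y X I f₁<f₀)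
inversionCount-adjacent {suc m} (suc k) f fₖ≢fₖ₊₁ =
  subst (λ t → OneApart t (inversionCount f)) (sym head-and-tail)
        (OneApart-+ C (inversionCount-adjacent k (f ∘ suc) fₖ≢fₖ₊₁))
  where
  C = countBelow (f zero) (f ∘ suc)
  lifted : ∀ x → f (adjacent (suc k) ⟨$⟩ʳ suc x) ≡ f (suc (adjacent k ⟨$⟩ʳ x))
  lifted = cong f ∘ adjacent-suc k
  head-and-tail : inversionCount (f ∘ (adjacent (suc k) ⟨$⟩ʳ_)) ≡ C + inversionCount (f ∘ suc ∘ (adjacent k ⟨$⟩ʳ_))
  head-and-tail = cong₂ _+_ (trans (countBelow-cong _ lifted) (countBelow-adjacent (f zero) k (f ∘ suc)))
                            (inversionCount-cong lifted)

parity-OneApart : ∀ {a b} → OneApart a b → parity a ≡ 1ℙ ℙ.+ parity b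
parity-OneApart {b = b} (inj₁ refl) = ℙₚ.+-homo-+ 1 b
parity-OneApart {a = a} (inj₂ refl) =
  sym (trans (cong (1ℙ ℙ.+_) (ℙₚ.+-homo-+ 1 a)) (ℙₚ.⁻¹-involutive (parity a)))

inject₁≢suc : ∀ {m} (k : Fin m) → inject₁ k ≢ suc k
inject₁≢suc zero = λ ()
inject₁≢suc (suc k) = inject₁≢suc k ∘ suc-injective

-- Opaque so that an equation sign σ ≡ sign τ determines σ and τ during unification.
opaque
  sign : ∀ {n} → Sym n → Parity
  sign σ = parity (inversions σ)

opaque
  unfolding sign

  sign-cong : ∀ {n} {σ τ : Sym n} → σ P.≈ τ → sign σ ≡ sign τ
  sign-cong {σ = σ} {τ} σ≈τ = cong parity (begin
    inversions σ                          ≡⟨ inversions≡inversionCount σ ⟩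
    inversionCount (toℕ ∘ (σ ⟨$⟩ʳ_))      ≡⟨ inversionCount-cong (cong toℕ ∘ σ≈τ) ⟩
    inversionCount (toℕ ∘ (τ ⟨$⟩ʳ_))      ≡⟨ inversions≡inversionCount τ ⟨
    inversions τ                          ∎)
    where open ≡-Reasoning

  sign-id : ∀ {n} → sign (P.id {n}) ≡ 0ℙ
  sign-id {n} = cong parity (trans (inversions≡inversionCount (P.id {n})) (inversionCount-increasing {n} toℕ (λ _ _ i<j → i<j)))

  sign-·-adjacent : ∀ {m} (σ : Sym (suc m)) (k : Fin m) → sign (σ · adjacent k) ≡ 1ℙ ℙ.+ sign σ
  sign-·-adjacent {m} σ k = begin
    parity (inversions (σ · adjacent k))               ≡⟨ cong parity (inversions≡inversionCount (σ · adjacent k)) ⟩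
    parity (inversionCount (f ∘ (adjacent k ⟨$⟩ʳ_)))   ≡⟨ parity-OneApart (inversionCount-adjacent k f f-distinct) ⟩
    1ℙ ℙ.+ parity (inversionCount f)                   ≡⟨ cong (λ c → 1ℙ ℙ.+ parity c) (inversions≡inversionCount σ) ⟨
    1ℙ ℙ.+ sign σ                                      ∎
    where
    open ≡-Reasoning
    f : Fin (suc m) → ℕ
    f = toℕ ∘ (σ ⟨$⟩ʳ_)
    f-distinct : f (inject₁ k) ≢ f (suc k)
    f-distinct = inject₁≢suc k ∘ injective σ ∘ toℕ-injective

  sign-empty : (σ : Sym 0) → sign σ ≡ 0ℙ
  sign-empty σ = refl

  even⇒sign≡0ℙ : ∀ {n} {σ : Sym n} → IsEven σ → sign σ ≡ 0ℙ
  even⇒sign≡0ℙ (divides q eq) = trans (cong parity eq) (trans (ℙₚ.*-homo-* q 2) (ℙₚ.*-zeroʳ (parity q)))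

adjacents : ∀ {m} → List (Fin m) → Sym (suc m)
adjacents [] = P.id
adjacents (k ∷ ks) = adjacent k · adjacents ks

sign-·-adjacents : ∀ {m} (σ : Sym (suc m)) (ks : List (Fin m)) →
                   sign (σ · adjacents ks) ≡ sign σ ℙ.+ parity (length ks)
sign-·-adjacents σ [] = trans (sign-cong (λ _ → refl)) (sym (ℙₚ.+-identityʳ (sign σ)))
sign-·-adjacents σ (k ∷ ks) = begin
  sign (σ · (adjacent k · adjacents ks))     ≡⟨ sign-cong (λ _ → refl) ⟩
  sign ((σ · adjacent k) · adjacents ks)     ≡⟨ sign-·-adjacents (σ · adjacent k) ks ⟩
  sign (σ · adjacent k) ℙ.+ parity l         ≡⟨ cong (ℙ._+ parity l) (sign-·-adjacent σ k) ⟩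
  1ℙ ℙ.+ sign σ ℙ.+ parity l                 ≡⟨ ℙₚ.+-assoc 1ℙ (sign σ) (parity l) ⟩
  1ℙ ℙ.+ (sign σ ℙ.+ parity l)               ≡⟨ ℙ-x∙yz≈y∙xz 1ℙ (sign σ) (parity l) ⟩
  sign σ ℙ.+ (1ℙ ℙ.+ parity l)               ≡⟨ cong (sign σ ℙ.+_) (ℙₚ.+-homo-+ 1 l) ⟨
  sign σ ℙ.+ parity (suc l)                  ∎
  where
  open ≡-Reasoning
  l = length ks

sign-adjacents : ∀ {m} (ks : List (Fin m)) → sign (adjacents ks) ≡ parity (length ks)
sign-adjacents ks = begin
  sign (adjacents ks)                  ≡⟨ sign-cong (λ _ → refl) ⟩
  sign (P.id · adjacents ks)           ≡⟨ sign-·-adjacents P.id ks ⟩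
  sign P.id ℙ.+ parity (length ks)     ≡⟨ cong (ℙ._+ parity (length ks)) sign-id ⟩
  parity (length ks)                   ∎
  where open ≡-Reasoning

adjacents-++ : ∀ {m} (xs ys : List (Fin m)) → adjacents (xs ++ ys) P.≈ adjacents xs · adjacents ys
adjacents-++ [] ys _ = refl
adjacents-++ (x ∷ xs) ys i = cong (adjacent x ⟨$⟩ʳ_) (adjacents-++ xs ys i)

adjacents-lift : ∀ {m} (ks : List (Fin m)) → adjacents (map suc ks) P.≈ lift₀ (adjacents ks)
adjacents-lift [] = sym ∘ P.lift₀-id
adjacents-lift (k ∷ ks) i = begin
  adjacent (suc k) ⟨$⟩ʳ (adjacents (map suc ks) ⟨$⟩ʳ i)   ≡⟨ cong (adjacent (suc k) ⟨$⟩ʳ_) (adjacents-lift ks i) ⟩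
  adjacent (suc k) ⟨$⟩ʳ (lift₀ (adjacents ks) ⟨$⟩ʳ i)     ≡⟨ P.lift₀-transpose (inject₁ k) (suc k) _ ⟩
  lift₀ (adjacent k) ⟨$⟩ʳ (lift₀ (adjacents ks) ⟨$⟩ʳ i)   ≡⟨ P.lift₀-comp (adjacents ks) (adjacent k) i ⟩
  lift₀ (adjacent k · adjacents ks) ⟨$⟩ʳ i                ∎
  where open ≡-Reasoning

moveZeroTo : ∀ {m} → Fin (suc m) → List (Fin m)
moveZeroTo zero = []
moveZeroTo {suc m} (suc b) = map suc (moveZeroTo b) ++ zero ∷ []

adjacents-moveZeroTo : ∀ {m} (b : Fin (suc m)) → adjacents (moveZeroTo b) ⟨$⟩ʳ zero ≡ b
adjacents-moveZeroTo zero = refl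
adjacents-moveZeroTo {suc m} (suc b) = begin
  adjacents (map suc (moveZeroTo b) ++ zero ∷ []) ⟨$⟩ʳ zero  ≡⟨ adjacents-++ (map suc (moveZeroTo b)) (zero ∷ []) zero ⟩
  adjacents (map suc (moveZeroTo b)) ⟨$⟩ʳ suc zero          ≡⟨ adjacents-lift (moveZeroTo b) (suc zero) ⟩
  suc (adjacents (moveZeroTo b) ⟨$⟩ʳ zero)                   ≡⟨ cong suc (adjacents-moveZeroTo b) ⟩
  suc b                                                      ∎
  where open ≡-Reasoning

adjacent-decomposition : ∀ {m} (σ : Sym (suc m)) → ∃[ ks ] σ P.≈ adjacents ks
adjacent-decomposition {zero} σ = [] , λ { zero → Fin1-unique (σ ⟨$⟩ʳ zero) }
  where
  Fin1-unique : (x : Fin 1) → x ≡ zero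
  Fin1-unique zero = refl
adjacent-decomposition {suc m} σ = moveZeroTo (σ ⟨$⟩ʳ zero) ++ map suc ks , σ≈
  where
  μ = adjacents (moveZeroTo (σ ⟨$⟩ʳ zero))
  ρ = flip μ · σ
  ρ-fixes-zero : ρ ⟨$⟩ʳ zero ≡ zero
  ρ-fixes-zero = trans (cong (flip μ ⟨$⟩ʳ_) (sym (adjacents-moveZeroTo (σ ⟨$⟩ʳ zero)))) (inverseˡ μ)
  ks = proj₁ (adjacent-decomposition (remove zero ρ))
  σ≈ : σ P.≈ adjacents (moveZeroTo (σ ⟨$⟩ʳ zero) ++ map suc ks)
  σ≈ i = begin
    σ ⟨$⟩ʳ i                          ≡⟨ inverseʳ μ ⟨
    μ ⟨$⟩ʳ (ρ ⟨$⟩ʳ i)                 ≡⟨ cong (μ ⟨$⟩ʳ_) (P.lift₀-remove ρ ρ-fixes-zero i) ⟨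
    μ ⟨$⟩ʳ (lift₀ (remove zero ρ) ⟨$⟩ʳ i)    ≡⟨ cong (μ ⟨$⟩ʳ_) (P.lift₀-cong _ _ (proj₂ (adjacent-decomposition (remove zero ρ))) i) ⟩
    μ ⟨$⟩ʳ (lift₀ (adjacents ks) ⟨$⟩ʳ i)     ≡⟨ cong (μ ⟨$⟩ʳ_) (adjacents-lift ks i) ⟨
    μ ⟨$⟩ʳ (adjacents (map suc ks) ⟨$⟩ʳ i)   ≡⟨ adjacents-++ (moveZeroTo (σ ⟨$⟩ʳ zero)) (map suc ks) i ⟨
    adjacents (moveZeroTo (σ ⟨$⟩ʳ zero) ++ map suc ks) ⟨$⟩ʳ i ∎
    where open ≡-Reasoning

sign-· : ∀ {n} (σ τ : Sym n) → sign (σ · τ) ≡ sign σ ℙ.+ sign τ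
sign-· {zero} σ τ = trans (sign-empty (σ · τ)) (sym (cong₂ ℙ._+_ (sign-empty σ) (sign-empty τ)))
sign-· {suc m} σ τ = begin
  sign (σ · τ)                         ≡⟨ sign-cong (cong (σ ⟨$⟩ʳ_) ∘ τ≈) ⟩
  sign (σ · adjacents ks)              ≡⟨ sign-·-adjacents σ ks ⟩
  sign σ ℙ.+ parity (length ks)        ≡⟨ cong (sign σ ℙ.+_) (sign-adjacents ks) ⟨
  sign σ ℙ.+ sign (adjacents ks)       ≡⟨ cong (sign σ ℙ.+_) (sign-cong τ≈) ⟨
  sign σ ℙ.+ sign τ                    ∎
  where
  open ≡-Reasoning
  ks = proj₁ (adjacent-decomposition τ)
  τ≈ = proj₂ (adjacent-decomposition τ)

sign-flip : ∀ {n} (σ : Sym n) → sign (flip σ) ≡ sign σ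
sign-flip σ = ℙₚ.+-cancelˡ-≡ (sign σ) _ _ (begin
  sign σ ℙ.+ sign (flip σ)  ≡⟨ sign-· σ (flip σ) ⟨
  sign (σ · flip σ)         ≡⟨ sign-cong (·-inverseʳ σ) ⟩
  sign P.id                 ≡⟨ sign-id ⟩
  0ℙ                        ≡⟨ ℙₚ.p+p≡0ℙ (sign σ) ⟨
  sign σ ℙ.+ sign σ         ∎)
  where open ≡-Reasoning

sign-conj : ∀ {n} (π σ : Sym n) → sign ((π · σ) · flip π) ≡ sign σ
sign-conj π σ = begin
  sign ((π · σ) · flip π)                     ≡⟨ trans (sign-· (π · σ) (flip π)) (cong₂ ℙ._+_ (sign-· π σ) (sign-flip π)) ⟩
  sign π ℙ.+ sign σ ℙ.+ sign π                ≡⟨ cong (ℙ._+ sign π) (ℙₚ.+-comm (sign π) (sign σ)) ⟩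
  sign σ ℙ.+ sign π ℙ.+ sign π                ≡⟨ ℙₚ.+-assoc (sign σ) (sign π) (sign π) ⟩
  sign σ ℙ.+ (sign π ℙ.+ sign π)              ≡⟨ cong (sign σ ℙ.+_) (ℙₚ.p+p≡0ℙ (sign π)) ⟩
  sign σ ℙ.+ 0ℙ                               ≡⟨ ℙₚ.+-identityʳ (sign σ) ⟩
  sign σ                                      ∎
  where open ≡-Reasoning

sign-transpose : ∀ {n} {a b : Fin n} → a ≢ b → sign (transpose a b) ≡ 1ℙ
sign-transpose {zero} {()}
sign-transpose {suc zero} {zero} {zero} a≢b = contradiction refl a≢b
sign-transpose {suc (suc m)} {a} {b} a≢b with 2-transitive {a = zero} {b = suc zero} (λ ()) a≢b
... | π , π₀ , π₁ = begin
  sign (transpose a b)                               ≡⟨ cong sign (cong₂ transpose π₀ π₁) ⟨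
  sign (transpose (π ⟨$⟩ʳ zero) (π ⟨$⟩ʳ suc zero))   ≡⟨ sign-cong (transpose-conj π zero (suc zero)) ⟨
  sign ((π · adjacent zero) · flip π)                  ≡⟨ sign-conj π (adjacent zero) ⟩
  sign (P.id · adjacent zero)                        ≡⟨ sign-·-adjacent P.id zero ⟩
  1ℙ ℙ.+ sign P.id                                   ≡⟨ cong (1ℙ ℙ.+_) sign-id ⟩
  1ℙ                                                 ∎
  where open ≡-Reasoning

sign-≡-if-quotient-even : ∀ {n} {σ τ : Sym n} → sign (flip σ · τ) ≡ 0ℙ → sign σ ≡ sign τ
sign-≡-if-quotient-even {σ = σ} {τ} quotient-even = ℙₚ.+-cancelʳ-≡ (sign τ) (sign σ) (sign τ) (begin
  sign σ ℙ.+ sign τ          ≡⟨ cong (ℙ._+ sign τ) (sign-flip σ) ⟨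
  sign (flip σ) ℙ.+ sign τ   ≡⟨ sign-· (flip σ) τ ⟨
  sign (flip σ · τ)          ≡⟨ quotient-even ⟩
  0ℙ                         ≡⟨ ℙₚ.p+p≡0ℙ (sign τ) ⟨
  sign τ ℙ.+ sign τ          ∎)
  where open ≡-Reasoning

moved-point : ∀ {n} {σ : Sym n} → sign σ ≡ 1ℙ → ∃[ a ] σ ⟨$⟩ʳ a ≢ a
moved-point {n} {σ} σ-odd = ¬∀⟶∃¬ n (λ a → σ ⟨$⟩ʳ a ≡ a) (λ a → σ ⟨$⟩ʳ a ≟ a)
  (λ σ≈id → contradiction (trans (sym sign-id) (trans (sign-cong (sym ∘ σ≈id)) σ-odd)) (λ ()))

record IsNormalSubgroup {n q} (N : Sym n → Set q) : Set q where
  field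
    ∈-resp-≈ : ∀ {σ τ} → σ P.≈ τ → N σ → N τ
    id-∈     : N P.id
    ·-∈      : ∀ {σ τ} → N σ → N τ → N (σ · τ)
    flip-∈   : ∀ {σ} → N σ → N (flip σ)
    conj-∈   : ∀ π {σ} → N σ → N ((π · σ) · flip π)

trivial-normal : ∀ {n} → IsNormalSubgroup {n} (P._≈ P.id)
trivial-normal = record
  { ∈-resp-≈ = λ σ≈τ σ≈id x → trans (sym (σ≈τ x)) (σ≈id x)
  ; id-∈     = λ _ → refl
  ; ·-∈      = λ {σ} σ≈id τ≈id x → trans (cong (σ ⟨$⟩ʳ_) (τ≈id x)) (σ≈id x)
  ; flip-∈   = λ {σ} σ≈id x → trans (cong (flip σ ⟨$⟩ʳ_) (sym (σ≈id x))) (inverseˡ σ)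
  ; conj-∈   = λ π {σ} σ≈id x → trans (cong (π ⟨$⟩ʳ_) (σ≈id (flip π ⟨$⟩ʳ x))) (inverseʳ π)
  }

even-normal : ∀ {n} → IsNormalSubgroup {n} (λ σ → sign σ ≡ 0ℙ)
even-normal = record
  { ∈-resp-≈ = λ σ≈τ σ-even → trans (sign-cong (sym ∘ σ≈τ)) σ-even
  ; id-∈     = sign-id
  ; ·-∈      = λ {σ} {τ} σ-even τ-even → trans (sign-· σ τ) (cong₂ ℙ._+_ σ-even τ-even)
  ; flip-∈   = λ {σ} σ-even → trans (sign-flip σ) σ-even
  ; conj-∈   = λ π {σ} σ-even → trans (sign-conj π σ) σ-even
  }

guarded-normal : ∀ {n q} (A : Set) {N : Sym n → Set q} → IsNormalSubgroup N → IsNormalSubgroup (λ σ → A → N σ)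
guarded-normal A N-normal = record
  { ∈-resp-≈ = λ σ≈τ Nσ a → ∈-resp-≈ σ≈τ (Nσ a)
  ; id-∈     = λ _ → id-∈
  ; ·-∈      = λ Nσ Nτ a → ·-∈ (Nσ a) (Nτ a)
  ; flip-∈   = λ Nσ a → flip-∈ (Nσ a)
  ; conj-∈   = λ π Nσ a → conj-∈ π (Nσ a)
  }
  where open IsNormalSubgroup N-normal

×-normal : ∀ {n q} {N M : Sym n → Set q} → IsNormalSubgroup N → IsNormalSubgroup M →
           IsNormalSubgroup (λ σ → N σ × M σ)
×-normal N-normal M-normal = record
  { ∈-resp-≈ = λ σ≈τ (Nσ , Mσ) → N.∈-resp-≈ σ≈τ Nσ , M.∈-resp-≈ σ≈τ Mσ
  ; id-∈     = N.id-∈ , M.id-∈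
  ; ·-∈      = λ (Nσ , Mσ) (Nτ , Mτ) → N.·-∈ Nσ Nτ , M.·-∈ Mσ Mτ
  ; flip-∈   = λ (Nσ , Mσ) → N.flip-∈ Nσ , M.flip-∈ Mσ
  ; conj-∈   = λ π (Nσ , Mσ) → N.conj-∈ π Nσ , M.conj-∈ π Mσ
  }
  where
  module N = IsNormalSubgroup N-normal
  module M = IsNormalSubgroup M-normal

ContainsTranspositionPairs : ∀ {n q} → (Sym n → Set q) → Set q
ContainsTranspositionPairs N = ∀ {a b c d} → a ≢ b → c ≢ d → N (transpose a b · transpose c d)

even-∈ : ∀ {n q} {N : Sym n → Set q} → IsNormalSubgroup N → ContainsTranspositionPairs N →
         ∀ σ → sign σ ≡ 0ℙ → N σ
even-∈ {zero} N-normal pairs σ _ = IsNormalSubgroup.∈-resp-≈ N-normal (λ ()) (IsNormalSubgroup.id-∈ N-normal)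
even-∈ {suc m} {N = N} N-normal pairs σ σ-even =
  ∈-resp-≈ (sym ∘ σ≈) (even-adjacents ks (begin
    parity (length ks)                   ≡⟨ sign-adjacents ks ⟨
    sign (adjacents ks)                  ≡⟨ sign-cong (sym ∘ σ≈) ⟩
    sign σ                               ≡⟨ σ-even ⟩
    0ℙ                                   ∎))
  where
  open IsNormalSubgroup N-normal
  open ≡-Reasoning
  ks = proj₁ (adjacent-decomposition σ)
  σ≈ = proj₂ (adjacent-decomposition σ)
  even-adjacents : (ks : List (Fin m)) → parity (length ks) ≡ 0ℙ → N (adjacents ks)
  even-adjacents [] _ = id-∈
  even-adjacents (k ∷ []) ()
  even-adjacents (k ∷ k′ ∷ ks) ks-even = ∈-resp-≈ (λ _ → refl)
    (·-∈ (pairs (inject₁≢suc k) (inject₁≢suc k′)) (even-adjacents ks ks-even))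

module _ {n q} {N : Sym n → Set q} (N-normal : IsNormalSubgroup N) where

  open IsNormalSubgroup N-normal

  private
    Pair : Fin n → Fin n → Fin n → Fin n → Set q
    Pair a b c d = N (transpose a b · transpose c d)

  pair-refl : ∀ a b → Pair a b a b
  pair-refl a b = ∈-resp-≈ (λ x → sym (transpose-involutive a b x)) id-∈

  pair-swapˡ : ∀ {a b c d} → Pair a b c d → Pair b a c d
  pair-swapˡ {a} {b} {c} {d} = ∈-resp-≈ (λ x → transpose-comm a b (transpose c d ⟨$⟩ʳ x))

  pair-swapʳ : ∀ {a b c d} → Pair a b c d → Pair a b d c
  pair-swapʳ {a} {b} {c} {d} = ∈-resp-≈ (λ x → cong (transpose a b ⟨$⟩ʳ_) (transpose-comm c d x))

  pair-sym : ∀ {a b c d} → Pair a b c d → Pair c d a b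
  pair-sym {a} {b} {c} {d} p = ∈-resp-≈ (λ x →
    trans (transpose-comm d c (transpose b a ⟨$⟩ʳ x)) (cong (transpose c d ⟨$⟩ʳ_) (transpose-comm b a x))) (flip-∈ p)

  pair-trans : ∀ {a b c d e f} → Pair a b c d → Pair c d e f → Pair a b e f
  pair-trans {a} {b} {c} {d} {e} {f} p q =
    ∈-resp-≈ (λ x → cong (transpose a b ⟨$⟩ʳ_) (transpose-involutive c d (transpose e f ⟨$⟩ʳ x))) (·-∈ p q)

  pair-conj : ∀ π {a b c d a′ b′ c′ d′} →
              π ⟨$⟩ʳ a ≡ a′ → π ⟨$⟩ʳ b ≡ b′ → π ⟨$⟩ʳ c ≡ c′ → π ⟨$⟩ʳ d ≡ d′ →
              Pair a b c d → Pair a′ b′ c′ d′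
  pair-conj π {a} {b} {c} {d} refl refl refl refl p = ∈-resp-≈ conj-pair (conj-∈ π p)
    where
    conj-pair : (π · (transpose a b · transpose c d)) · flip π P.≈
                transpose (π ⟨$⟩ʳ a) (π ⟨$⟩ʳ b) · transpose (π ⟨$⟩ʳ c) (π ⟨$⟩ʳ d)
    conj-pair x = begin
      π ⟨$⟩ʳ (transpose a b ⟨$⟩ʳ y)                       ≡⟨ cong (λ z → π ⟨$⟩ʳ (transpose a b ⟨$⟩ʳ z)) (inverseˡ π) ⟨
      π ⟨$⟩ʳ (transpose a b ⟨$⟩ʳ (flip π ⟨$⟩ʳ (π ⟨$⟩ʳ y))) ≡⟨ transpose-conj π a b (π ⟨$⟩ʳ y) ⟩
      transpose (π ⟨$⟩ʳ a) (π ⟨$⟩ʳ b) ⟨$⟩ʳ (π ⟨$⟩ʳ y)    ≡⟨ cong (transpose (π ⟨$⟩ʳ a) (π ⟨$⟩ʳ b) ⟨$⟩ʳ_) (transpose-conj π c d x) ⟩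
      transpose (π ⟨$⟩ʳ a) (π ⟨$⟩ʳ b) ⟨$⟩ʳ (transpose (π ⟨$⟩ʳ c) (π ⟨$⟩ʳ d) ⟨$⟩ʳ x) ∎
      where
      open ≡-Reasoning
      y = transpose c d ⟨$⟩ʳ (flip π ⟨$⟩ʳ x)

  pair-commutator : ∀ {σ} → N σ → ∀ a b → Pair a b (σ ⟨$⟩ʳ a) (σ ⟨$⟩ʳ b)
  pair-commutator {σ} Nσ a b = ∈-resp-≈ commutator (·-∈ (conj-∈ (transpose a b) Nσ) (flip-∈ Nσ))
    where
    commutator : ((transpose a b · σ) · flip (transpose a b)) · flip σ P.≈
                 transpose a b · transpose (σ ⟨$⟩ʳ a) (σ ⟨$⟩ʳ b)
    commutator x = trans (cong (λ y → transpose a b ⟨$⟩ʳ (σ ⟨$⟩ʳ y)) (transpose-comm b a (flip σ ⟨$⟩ʳ x)))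
                         (cong (transpose a b ⟨$⟩ʳ_) (transpose-conj σ a b x))

  pairs-from-3-cycle : ∀ {x y z} → x ≢ y → x ≢ z → y ≢ z → Pair x y x z → ContainsTranspositionPairs N
  pairs-from-3-cycle {x} {y} {z} x≢y x≢z y≢z cycle = pair
    where
    sharing : ∀ {p u v} → p ≢ u → p ≢ v → Pair p u p v
    sharing {p} {u} {v} p≢u p≢v with u ≟ v
    ... | yes refl = pair-refl p u
    ... | no u≢v with 3-transitive x≢y x≢z y≢z p≢u p≢v u≢v
    ...   | π , πx , πy , πz = pair-conj π πx πy πx πz cycle
    pair : ContainsTranspositionPairs N
    pair {a} {b} {c} {d} a≢b c≢d with d ≟ a
    ... | yes refl = pair-swapʳ (sharing a≢b (≢-sym c≢d))
    ... | no d≢a = pair-trans (sharing a≢b (≢-sym d≢a)) (pair-swapˡ (pair-swapʳ (sharing d≢a (≢-sym c≢d))))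

  pairs-from-two-points : ∀ {a b} → (∀ x → x ≡ a ⊎ x ≡ b) → ContainsTranspositionPairs N
  pairs-from-two-points {a} {b} among {u} {v} {u′} {v′} u≢v u′≢v′ = ∈-resp-≈ (λ x → sym (begin
    transpose u v ⟨$⟩ʳ (transpose u′ v′ ⟨$⟩ʳ x) ≡⟨ cong (transpose u v ⟨$⟩ʳ_) (transpose-among-two among u′≢v′ x) ⟩
    transpose u v ⟨$⟩ʳ (transpose a b ⟨$⟩ʳ x)  ≡⟨ transpose-among-two among u≢v (transpose a b ⟨$⟩ʳ x) ⟩
    transpose a b ⟨$⟩ʳ (transpose a b ⟨$⟩ʳ x)  ∎)) (pair-refl a b)
    where open ≡-Reasoning

  -- Each commutator (a b) σ (a b) σ⁻¹ = (a b)(σa σb) lies in N; the cases look for one that is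
  -- a 3-cycle.
  pairs-from-odd : ∀ {σ} → N σ → sign σ ≡ 1ℙ → ContainsTranspositionPairs N
  pairs-from-odd {σ} Nσ σ-odd = from-moved (moved-point σ-odd)
    where
    s : Fin n → Fin n
    s = σ ⟨$⟩ʳ_

    s-≢ : ∀ {x y} → x ≢ y → s x ≢ s y
    s-≢ x≢y = x≢y ∘ injective σ

    from-3-cycle-of-σ : ∀ {a} → s a ≢ a → s (s a) ≢ a → ContainsTranspositionPairs N
    from-3-cycle-of-σ {a} sa≢a ssa≢a =
      pairs-from-3-cycle sa≢a (s-≢ (≢-sym sa≢a)) (≢-sym ssa≢a) (pair-swapˡ (pair-commutator Nσ a (s a)))

    σ-is-two-swaps : ∀ {a d} → s (s a) ≡ a → s (s d) ≡ d → d ≢ a → d ≢ s a → s d ≢ a → s d ≢ s a →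
                     ¬ (∃[ z ] z ≢ a × z ≢ s a × z ≢ d × z ≢ s d) →
                     σ P.≈ transpose a (s a) · transpose d (s d)
    σ-is-two-swaps {a} {d} ssa≡a ssd≡d d≢a d≢sa sd≢a sd≢sa none x with among-four none x
    ... | inj₁ refl = sym (trans (cong (transpose x (s x) ⟨$⟩ʳ_) (transpose-fix (≢-sym d≢a) (≢-sym sd≢a))) (transpose-ˡ x (s x)))
    ... | inj₂ (inj₁ refl) = trans ssa≡a (sym (trans (cong (transpose a x ⟨$⟩ʳ_) (transpose-fix (≢-sym d≢sa) (≢-sym sd≢sa))) (transpose-ʳ a x)))
    ... | inj₂ (inj₂ (inj₁ refl)) = sym (trans (cong (transpose a (s a) ⟨$⟩ʳ_) (transpose-ˡ x (s x))) (transpose-fix sd≢a sd≢sa))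
    ... | inj₂ (inj₂ (inj₂ refl)) = trans ssd≡d (sym (trans (cong (transpose a (s a) ⟨$⟩ʳ_) (transpose-ʳ d x)) (transpose-fix d≢a d≢sa)))

    partner-≢ : ∀ {a d} → s (s d) ≡ d → d ≢ s a → s d ≢ a
    partner-≢ ssd≡d d≢sa sd≡a = d≢sa (trans (sym ssd≡d) (cong s sd≡a))

    -- σ swaps a ↔ σa and d ↔ σd. Being odd, σ is not (a σa)(d σd), so a fifth point z exists,
    -- and conjugating the commutator (a d)(σa σd) by (σd z) gives (a d)(σa z).
    from-two-swaps : ∀ {a d} → s (s a) ≡ a → s (s d) ≡ d → s a ≢ a → s d ≢ d → d ≢ a → d ≢ s a →
                     ContainsTranspositionPairs N
    from-two-swaps {a} {d} ssa≡a ssd≡d sa≢a sd≢d d≢a d≢sa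
      with any? (λ z → ¬? (z ≟ a) ×-dec ¬? (z ≟ s a) ×-dec ¬? (z ≟ d) ×-dec ¬? (z ≟ s d))
    ... | yes (z , z≢a , z≢sa , z≢d , z≢sd) =
      pairs-from-3-cycle (s-≢ (≢-sym d≢a)) (≢-sym z≢sa) (≢-sym z≢sd) (pair-trans (pair-sym δ) δ′)
      where
      sd≢a = partner-≢ ssd≡d d≢sa
      sd≢sa = s-≢ d≢a
      δ = pair-commutator Nσ a d
      δ′ = pair-conj (transpose (s d) z) (transpose-fix (≢-sym sd≢a) (≢-sym z≢a)) (transpose-fix (≢-sym sd≢d) (≢-sym z≢d))
                     (transpose-fix (≢-sym sd≢sa) (≢-sym z≢sa)) (transpose-ˡ (s d) z) δ
    ... | no none = contradiction (begin
      1ℙ                                                  ≡⟨ σ-odd ⟨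
      sign σ                                              ≡⟨ sign-cong (σ-is-two-swaps ssa≡a ssd≡d d≢a d≢sa (partner-≢ ssd≡d d≢sa) (s-≢ d≢a) none) ⟩
      sign (transpose a (s a) · transpose d (s d))        ≡⟨ sign-· (transpose a (s a)) (transpose d (s d)) ⟩
      sign (transpose a (s a)) ℙ.+ sign (transpose d (s d)) ≡⟨ cong₂ ℙ._+_ (sign-transpose (≢-sym sa≢a)) (sign-transpose (≢-sym sd≢d)) ⟩
      0ℙ                                                  ∎) (λ ())
      where open ≡-Reasoning

    from-moved : ∃[ a ] s a ≢ a → ContainsTranspositionPairs N
    from-moved (a , sa≢a) with s (s a) ≟ a
    ... | no ssa≢a = from-3-cycle-of-σ sa≢a ssa≢a
    ... | yes ssa≡a with any? (λ d → ¬? (d ≟ a) ×-dec ¬? (d ≟ s a))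
    ...   | no none = pairs-from-two-points (among-two none)
    ...   | yes (d , d≢a , d≢sa) with s d ≟ d
    ...     | yes sd≡d = pairs-from-3-cycle d≢a d≢sa (≢-sym sa≢a)
                           (pair-swapˡ (pair-swapʳ (subst (Pair a d (s a)) sd≡d (pair-commutator Nσ a d))))
    ...     | no sd≢d with s (s d) ≟ d
    ...       | no ssd≢d = from-3-cycle-of-σ sd≢d ssd≢d
    ...       | yes ssd≡d = from-two-swaps ssa≡a ssd≡d sa≢a sd≢d d≢a d≢sa

  full-if-sign-surjective : (∀ τ → ∃[ σ ] N σ × sign σ ≡ sign τ) → ∀ τ → N τ
  full-if-sign-surjective sign-onto τ with sign-onto τ
  ... | σ , Nσ , σ∼τ = ∈-resp-≈ (λ _ → inverseʳ σ) (·-∈ Nσ (even-∈ N-normal pairs (flip σ · τ) (begin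
    sign (flip σ · τ)          ≡⟨ sign-· (flip σ) τ ⟩
    sign (flip σ) ℙ.+ sign τ   ≡⟨ cong (ℙ._+ sign τ) (trans (sign-flip σ) σ∼τ) ⟩
    sign τ ℙ.+ sign τ          ≡⟨ ℙₚ.p+p≡0ℙ (sign τ) ⟩
    0ℙ                         ∎)))
    where
    open ≡-Reasoning
    pairs : ContainsTranspositionPairs N
    pairs {a} {b} a≢b with sign-onto (transpose a b)
    ... | ρ , Nρ , ρ∼ab = pairs-from-odd Nρ (trans ρ∼ab (sign-transpose a≢b)) a≢b

module _ {c ℓ r n} (G : Group c ℓ) (α : Fin r → Group.Carrier G → Sym n)
         (α-isHom : ∀ i → GroupMorphisms.IsGroupHomomorphism (Group.rawGroup G) (SymRaw n) (α i))
         (α-surj : ∀ i → Surjective (Group._≈_ G) P._≈_ (α i)) where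

  open Group G using (_∙_; _⁻¹; ε) renaming (refl to G-refl)
  module α-hom (i : Fin r) = GroupMorphisms.IsGroupHomomorphism (α-isHom i)

  α-conj : ∀ i u g → α i ((u ∙ g) ∙ u ⁻¹) P.≈ (α i u · α i g) · flip (α i u)
  α-conj i u g x = begin
    α i ((u ∙ g) ∙ u ⁻¹) ⟨$⟩ʳ x                         ≡⟨ α-hom.homo i (u ∙ g) (u ⁻¹) x ⟩
    α i (u ∙ g) ⟨$⟩ʳ (α i (u ⁻¹) ⟨$⟩ʳ x)                ≡⟨ α-hom.homo i u g _ ⟩
    α i u ⟨$⟩ʳ (α i g ⟨$⟩ʳ (α i (u ⁻¹) ⟨$⟩ʳ x))         ≡⟨ cong (λ y → α i u ⟨$⟩ʳ (α i g ⟨$⟩ʳ y)) (α-hom.⁻¹-homo i u x) ⟩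
    α i u ⟨$⟩ʳ (α i g ⟨$⟩ʳ (flip (α i u) ⟨$⟩ʳ x))       ∎
    where open ≡-Reasoning

  module _ (K : Fin r → Sym n → Set) (K-normal : ∀ i → IsNormalSubgroup (K i)) (j : Fin r) where

    module K (i : Fin r) = IsNormalSubgroup (K-normal i)

    ConstrainedImage : Sym n → Set c
    ConstrainedImage σ = ∃[ g ] α j g P.≈ σ × (∀ i → K i (α i g))

    constrainedImage-normal : IsNormalSubgroup ConstrainedImage
    constrainedImage-normal = record
      { ∈-resp-≈ = λ σ≈τ (g , αg≈σ , Kg) → g , (λ x → trans (αg≈σ x) (σ≈τ x)) , Kg
      ; id-∈     = ε , α-hom.ε-homo j , λ i → K.∈-resp-≈ i (sym ∘ α-hom.ε-homo i) (K.id-∈ i)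
      ; ·-∈      = λ (g , αg≈σ , Kg) (h , αh≈τ , Kh) →
          g ∙ h , (λ x → trans (α-hom.homo j g h x) (trans (cong (α j g ⟨$⟩ʳ_) (αh≈τ x)) (αg≈σ _))) ,
          λ i → K.∈-resp-≈ i (sym ∘ α-hom.homo i g h) (K.·-∈ i (Kg i) (Kh i))
      ; flip-∈   = λ {σ} (g , αg≈σ , Kg) →
          g ⁻¹ , (λ x → trans (α-hom.⁻¹-homo j g x) (flip-cong {σ = α j g} {τ = σ} αg≈σ x)) ,
          λ i → K.∈-resp-≈ i (sym ∘ α-hom.⁻¹-homo i g) (K.flip-∈ i (Kg i))
      ; conj-∈   = conj
      }
      where
      conj : ∀ π {σ} → ConstrainedImage σ → ConstrainedImage ((π · σ) · flip π)
      conj π {σ} (g , αg≈σ , Kg) = (u ∙ g) ∙ u ⁻¹ , αj≈ ,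
        λ i → K.∈-resp-≈ i (sym ∘ α-conj i u g) (K.conj-∈ i (α i u) (Kg i))
        where
        u = proj₁ (α-surj j π)
        αu≈π : α j u P.≈ π
        αu≈π = proj₂ (α-surj j π) G-refl
        αj≈ : α j ((u ∙ g) ∙ u ⁻¹) P.≈ (π · σ) · flip π
        αj≈ x = begin
          α j ((u ∙ g) ∙ u ⁻¹) ⟨$⟩ʳ x                   ≡⟨ α-conj j u g x ⟩
          α j u ⟨$⟩ʳ (α j g ⟨$⟩ʳ (flip (α j u) ⟨$⟩ʳ x)) ≡⟨ cong (λ y → α j u ⟨$⟩ʳ (α j g ⟨$⟩ʳ y)) (flip-cong {σ = α j u} {τ = π} αu≈π x) ⟩
          α j u ⟨$⟩ʳ (α j g ⟨$⟩ʳ (flip π ⟨$⟩ʳ x))       ≡⟨ cong (α j u ⟨$⟩ʳ_) (αg≈σ _) ⟩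
          α j u ⟨$⟩ʳ (σ ⟨$⟩ʳ (flip π ⟨$⟩ʳ x))           ≡⟨ αu≈π _ ⟩
          π ⟨$⟩ʳ (σ ⟨$⟩ʳ (flip π ⟨$⟩ʳ x))               ∎
          where open ≡-Reasoning

  LiftableUpTo : ℕ → Set c
  LiftableUpTo k = ∀ (x : Fin r → Sym n) →
    ∃[ g ] (∀ i → toℕ i < k → α i g P.≈ x i) × (∀ i → k ≤ toℕ i → sign (α i g) ≡ sign (x i))

  liftable-zero : Surjective (Group._≈_ G) _≈A_ (λ g i → α i g) → LiftableUpTo 0
  liftable-zero β x = proj₁ (β x) , (λ _ ()) ,
    λ i _ → sign-≡-if-quotient-even (even⇒sign≡0ℙ (proj₂ (β x) G-refl i))

  module Step {k} (k<r : k < r) (liftable : LiftableUpTo k) where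

    j : Fin r
    j = fromℕ< k<r

    toℕ-j : toℕ j ≡ k
    toℕ-j = toℕ-fromℕ< k<r

    below⇒≢j : ∀ {i} → toℕ i < k → i ≢ j
    below⇒≢j i<k refl = <⇒≢ i<k toℕ-j

    above⇒≢j : ∀ {i} → k < toℕ i → i ≢ j
    above⇒≢j k<i refl = <⇒≢ k<i (sym toℕ-j)

    K : Fin r → Sym n → Set
    K i σ = (toℕ i < k → σ P.≈ P.id) × (k < toℕ i → sign σ ≡ 0ℙ)

    K-normal : ∀ i → IsNormalSubgroup (K i)
    K-normal i = ×-normal (guarded-normal _ trivial-normal) (guarded-normal _ even-normal)

    N : Sym n → Set c
    N = ConstrainedImage K K-normal j

    N-sign-surjective : ∀ τ → ∃[ σ ] N σ × sign σ ≡ sign τ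
    N-sign-surjective τ with liftable (updateAt (λ _ → P.id) j (λ _ → τ))
    ... | g , agree , signs = α j g , (g , (λ _ → refl) , λ i → below i , above i) ,
      trans (signs j (≤-reflexive (sym toℕ-j))) (cong sign (updateAt-updates j (λ _ → P.id)))
      where
      below : ∀ i → toℕ i < k → α i g P.≈ P.id
      below i i<k x = trans (agree i i<k x) (cong (_⟨$⟩ʳ x) (updateAt-minimal i j (λ _ → P.id) (below⇒≢j i<k)))
      above : ∀ i → k < toℕ i → sign (α i g) ≡ 0ℙ
      above i k<i = trans (signs i (<⇒≤ k<i))
        (trans (cong sign (updateAt-minimal i j (λ _ → P.id) (above⇒≢j k<i))) sign-id)

    N-full : ∀ σ → N σ
    N-full = full-if-sign-surjective (constrainedImage-normal K K-normal j) N-sign-surjective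

    liftable-suc : LiftableUpTo (suc k)
    liftable-suc x with liftable x
    ... | g , agree , signs with N-full (flip (α j g) · x j)
    ...   | h , αh≈ , Kh = g ∙ h , agree′ , signs′
      where
      agree′ : ∀ i → toℕ i < suc k → α i (g ∙ h) P.≈ x i
      agree′ i i<1+k y with m<1+n⇒m<n∨m≡n i<1+k
      ... | inj₁ i<k = trans (α-hom.homo i g h y) (trans (cong (α i g ⟨$⟩ʳ_) (proj₁ (Kh i) i<k y)) (agree i i<k y))
      ... | inj₂ i≡k with toℕ-injective (trans i≡k (sym toℕ-j))
      ...   | refl = trans (α-hom.homo j g h y) (trans (cong (α j g ⟨$⟩ʳ_) (αh≈ y)) (inverseʳ (α j g)))
      signs′ : ∀ i → suc k ≤ toℕ i → sign (α i (g ∙ h)) ≡ sign (x i)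
      signs′ i k<i = begin
        sign (α i (g ∙ h))                ≡⟨ sign-cong (α-hom.homo i g h) ⟩
        sign (α i g · α i h)              ≡⟨ sign-· (α i g) (α i h) ⟩
        sign (α i g) ℙ.+ sign (α i h)     ≡⟨ cong₂ ℙ._+_ (signs i (<⇒≤ k<i)) (proj₂ (Kh i) k<i) ⟩
        sign (x i) ℙ.+ 0ℙ                 ≡⟨ ℙₚ.+-identityʳ (sign (x i)) ⟩
        sign (x i)                        ∎
        where open ≡-Reasoning

  liftable : Surjective (Group._≈_ G) _≈A_ (λ g i → α i g) → ∀ k → k ≤ r → LiftableUpTo k
  liftable β zero _ = liftable-zero β
  liftable β (suc k) k<r = Step.liftable-suc k<r (liftable β k (<⇒≤ k<r))

lemma3p2 : ∀ {c ℓ : Level} (r n : ℕ) → r ≥ 1 → n ≥ 1 → (G : Group c ℓ) →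
    (α : Fin r → Group.Carrier G → Sym n) →
    (∀ i → GroupMorphisms.IsGroupHomomorphism (Group.rawGroup G) (SymRaw n) (α i)) →
    (∀ i → Surjective (Group._≈_ G) P._≈_ (α i)) →
    Surjective (Group._≈_ G) _≈A_ (λ g i → α i g) →
    Surjective (Group._≈_ G) (RawGroup._≈_ (SymPowRaw r n)) (λ g i → α i g)
lemma3p2 r n _ _ G α α-hom α-surj β y with liftable G α α-hom α-surj β r ≤-refl y
... | g , agree , _ = g , λ z≈g i x → trans (α-cong i z≈g x) (agree i (toℕ<n i) x)
  where
  open GroupMorphisms (Group.rawGroup G) (SymRaw n) using (module IsGroupHomomorphism)
  α-cong : ∀ i {z g} → Group._≈_ G z g → α i z P.≈ α i g
  α-cong i = IsGroupHomomorphism.⟦⟧-cong (α-hom i)
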